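{- Let $M$ be a commutative ring with $n$ elements. Then $M$ is a meadow if and only if there are (not necessarily distinct) primes $p_1,\ldots,p_k$ and positive integers $n_1,\ldots,n_k$ such that \[ M\cong GF(p_1^{n_1})\times\cdots\times GF(p_k^{n_k}) \] and $n=p_1^{n_1}\cdots p_k^{n_k}$.
   Context: A commutative ring is a structure $\langle R,+,-,\cdot,0,1\rangle$ satisfying the usual axioms of a commutative ring with identity $1$. For $x\in R$, an element $y\in R$ with $x\cdot x\cdot y=x$ and $y\cdot y\cdot x=y$ is unique if it exists; it is called the generalized inverse of $x$, denoted $x^{ -1}$. A meadow is a commutative ring in which every element has a generalized inverse (viewed with the additional unary operation $x\mapsto x^{ -1}$). $GF(q)$ denotes the finite (Galois) field with $q$ elements, expanded to a meadow by the total inverse with $0^{ -1}=0$; products carry componentwise operations. -}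

module Defs where

open import Level using (Level; 0ℓ)
open import Data.Nat using (ℕ; zero; suc) renaming (_*_ to _*ℕ_)
open import Data.Fin using (Fin)
import Data.Fin as Fin
open import Data.Product using (Σ; ∃; _×_)
open import Relation.Nullary using (¬_)
open import Relation.Binary.Bundles using (Setoid)
import Relation.Binary.PropositionalEquality as ≡
open import Function.Bundles using (Inverse)
open import Algebra.Bundles using (CommutativeRing)
open import Algebra.Bundles.Raw using (RawRing)

private variable c ℓ : Level

HasCard : CommutativeRing c ℓ → ℕ → Set (c Level.⊔ ℓ)
HasCard R n = Inverse (≡.setoid (Fin n)) (CommutativeRing.setoid R)

IsMeadow : CommutativeRing c ℓ → Set (c Level.⊔ ℓ)
IsMeadow R = ∀ x → ∃ λ y → (x * x * y ≈ x) × (y * y * x ≈ y)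
  where open CommutativeRing R

IsField : CommutativeRing c ℓ → Set (c Level.⊔ ℓ)
IsField R = (¬ (1# ≈ 0#)) × (∀ x → ¬ (x ≈ 0#) → ∃ λ y → x * y ≈ 1#)
  where open CommutativeRing R

Field : Set₁
Field = Σ (CommutativeRing 0ℓ 0ℓ) IsField

ΠRaw : (k : ℕ) → (Fin k → Field) → RawRing 0ℓ 0ℓ
ΠRaw k F = record
  { Carrier = (i : Fin k) → C i
  ; _≈_ = λ x y → ∀ i → R._≈_ i (x i) (y i)
  ; _+_ = λ x y i → R._+_ i (x i) (y i)
  ; _*_ = λ x y i → R._*_ i (x i) (y i)
  ; -_ = λ x i → R.-_ i (x i)
  ; 0# = λ i → R.0# i
  ; 1# = λ i → R.1# i
  }
  where
  module R (i : Fin k) = CommutativeRing (Data.Product.proj₁ (F i))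
  C : Fin k → Set
  C i = R.Carrier i

∏ : (k : ℕ) → (Fin k → ℕ) → ℕ
∏ zero f = 1
∏ (suc k) f = f Fin.zero *ℕ ∏ k (λ i → f (Fin.suc i))

-- A finite meadow M splits along idempotents.  For x ∈ M the element x x⁻¹ is idempotent, and
-- below a nonzero idempotent e one finds, by descending through idempotents of the form x x⁻¹
-- (measured by |eM|), an idempotent f for which every nonzero x ∈ fM has x x⁻¹ = f, i.e. fM is a
-- field.  Then e = f + (e − f) with orthogonal idempotents gives eM ≅ fM × (e − f)M, and
-- iterating from e = 1 yields M ≅ ∏ fᵢM.  Each finite field F has prime characteristic p (some
-- N·1 vanishes by pigeonhole, hence so does p·1 for a prime factor p of N, F being a domain), and
-- F is a vector space over ℤ/p: independent families extended by vectors outside their span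
-- stay independent, so a basis of some size e exists and |F| = pᵉ.  Conversely a product of
-- fields is a meadow, with componentwise inverses and 0⁻¹ = 0.

module Submission where

open import Level using (Level; 0ℓ; _⊔_)
open import Data.Bool using (Bool; true; false; T; if_then_else_)
open import Data.Bool.Properties using (T-irrelevant)
open import Data.Empty using (⊥-elim)
open import Data.Fin as Fin using (Fin; zero; suc)
import Data.Fin.Properties as Finₚ
open import Data.List using ([]; _∷_)
open import Data.List.Relation.Unary.All using (All; []; _∷_)
open import Data.Nat as ℕ using (ℕ; _≤_; _<_; _^_)
import Data.Nat.Properties as ℕₚ
open import Data.Nat.Coprimality using (prime⇒coprime; coprime-Bézout)
open import Data.Nat.DivMod using (_%_; _/_; m%n<n; m≡m%n+[m/n]*n)
open import Data.Nat.GCD using (module Bézout)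
open import Data.Nat.Induction using (<-wellFounded)
open import Data.Nat.ListAction using (product)
open import Data.Nat.Primality using (Prime; prime⇒nonZero; prime⇒nonTrivial)
open import Data.Nat.Primality.Factorisation using (PrimeFactorisation; factorise)
open import Data.Product using (Σ; Σ-syntax; ∃; _×_; _,_; proj₁; proj₂)
open import Data.Product.Properties using (Σ-≡,≡→≡)
open import Data.Sum using (_⊎_; inj₁; inj₂)
open import Data.Sum.Function.Propositional using (_⊎-↔_)
import Data.Vec.Functional as Vector
open import Function using (_∘_; _on_; _↔_; _⇔_; mk⇔; mk↔ₛ′; Inverse; Injection)
open import Function.Properties.Inverse using (↔-refl; ↔-sym; ↔-trans; Inverse⇒Injection)
import Function.Construct.Composition as Compose
import Function.Construct.Symmetry as Symmetry
open import Induction.WellFounded using (WellFounded; Acc; acc)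
open import Relation.Nullary using (¬_; Dec; yes; no; ¬?; _×-dec_)
import Relation.Nullary.Decidable as Dec
open import Relation.Binary.Bundles using (Setoid)
open import Relation.Binary.Core using (Rel)
open import Relation.Binary.Definitions using (Decidable; tri<; tri≈; tri>)
import Relation.Binary.Construct.On as On
open import Relation.Binary.PropositionalEquality as ≡ using (_≡_; _≗_)
open import Algebra.Bundles using (CommutativeRing; RawRing)
open import Algebra.Structures using (IsCommutativeRing)
open import Algebra.Morphism.Structures using (module RingMorphisms)
import Algebra.Morphism.RingMonomorphism as RingMonomorphism
import Algebra.Properties.AbelianGroup as AbelianGroupₚ
import Algebra.Properties.CommutativeSemigroup as CommutativeSemigroupₚ
import Algebra.Properties.Group as Groupₚ
import Algebra.Properties.Monoid.Sum as MonoidSum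
import Algebra.Properties.Ring as Ringₚ
import Algebra.Properties.Semiring.Mult as SemiringMult
open import Defs

count : ∀ {n} → (Fin n → Bool) → ℕ
count {ℕ.zero} p = 0
count {ℕ.suc n} p = if p zero then ℕ.suc (count (p ∘ suc)) else count (p ∘ suc)

Σ-Fin-suc↔ : ∀ {n a} (P : Fin (ℕ.suc n) → Set a) →
             (P zero ⊎ Σ[ j ∈ Fin n ] P (suc j)) ↔ (Σ[ j ∈ Fin (ℕ.suc n) ] P j)
Σ-Fin-suc↔ P = mk↔ₛ′
  (λ { (inj₁ x) → zero , x ; (inj₂ (j , x)) → suc j , x })
  (λ { (zero , x) → inj₁ x ; (suc j , x) → inj₂ (j , x) })
  (λ { (zero , x) → ≡.refl ; (suc j , x) → ≡.refl })
  (λ { (inj₁ x) → ≡.refl ; (inj₂ (j , x)) → ≡.refl })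

Fin-if↔ : ∀ b c → Fin (if b then ℕ.suc c else c) ↔ (T b ⊎ Fin c)
Fin-if↔ true c = ↔-trans (Finₚ.+↔⊎ {1}) (Finₚ.1↔⊤ ⊎-↔ ↔-refl)
Fin-if↔ false c = mk↔ₛ′ inj₂ (λ { (inj₁ ()) ; (inj₂ a) → a }) (λ { (inj₁ ()) ; (inj₂ a) → ≡.refl }) (λ _ → ≡.refl)

Fin-count↔ : ∀ {n} (p : Fin n → Bool) → Fin (count p) ↔ (Σ[ j ∈ Fin n ] T (p j))
Fin-count↔ {ℕ.zero} p = mk↔ₛ′ (λ ()) (λ { (() , _) }) (λ { (() , _) }) (λ ())
Fin-count↔ {ℕ.suc n} p =
  ↔-trans (Fin-if↔ (p zero) _) (↔-trans (↔-refl ⊎-↔ Fin-count↔ (p ∘ suc)) (Σ-Fin-suc↔ (T ∘ p)))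

Σ-T-≡ : ∀ {a} {A : Set a} {p : A → Bool} {x y : Σ A (T ∘ p)} → proj₁ x ≡ proj₁ y → x ≡ y
Σ-T-≡ eq = Σ-≡,≡→≡ (eq , T-irrelevant _ _)

count-< : ∀ {n} (p q : Fin n → Bool) → (∀ j → T (p j) → T (q j)) →
          ∀ j → T (q j) → ¬ T (p j) → count p < count q
count-< p q p⊆q j qj ¬pj = Finₚ.injective⇒≤ {f = f} f-injective
  where
  module P = Inverse (Fin-count↔ p)
  module Q = Inverse (Fin-count↔ q)
  P-to-injective : ∀ {a b} → P.to a ≡ P.to b → a ≡ b
  P-to-injective = Injection.injective (Inverse⇒Injection (Fin-count↔ p))
  Q-from-injective : ∀ {x y} → Q.from x ≡ Q.from y → x ≡ y
  Q-from-injective = Injection.injective (Inverse⇒Injection (↔-sym (Fin-count↔ q)))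
  widen : Σ[ i ∈ Fin _ ] T (p i) → Σ[ i ∈ Fin _ ] T (q i)
  widen (i , pi) = i , p⊆q i pi
  f : Fin (ℕ.suc (count p)) → Fin (count q)
  f zero = Q.from (j , qj)
  f (suc a) = Q.from (widen (P.to a))
  j-new : ∀ a → ¬ (j , qj) ≡ widen (P.to a)
  j-new a eq = ¬pj (≡.subst (T ∘ p) (≡.cong proj₁ (≡.sym eq)) (proj₂ (P.to a)))
  f-injective : ∀ {a b} → f a ≡ f b → a ≡ b
  f-injective {zero} {zero} _ = ≡.refl
  f-injective {zero} {suc b} eq = ⊥-elim (j-new b (Q-from-injective eq))
  f-injective {suc a} {zero} eq = ⊥-elim (j-new a (Q-from-injective (≡.sym eq)))
  f-injective {suc a} {suc b} eq = ≡.cong suc (P-to-injective (Σ-T-≡ (≡.cong proj₁ (Q-from-injective eq))))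

injection⇒≤ : ∀ {s₁ s₂ t₁ t₂} {S : Setoid s₁ s₂} {T : Setoid t₁ t₂} {a b} →
  Inverse (≡.setoid (Fin a)) S → Inverse (≡.setoid (Fin b)) T → Injection S T → a ≤ b
injection⇒≤ A B f = Finₚ.injective⇒≤ (Injection.injective
  (Compose.injection (Compose.injection (Inverse⇒Injection A) f) (Inverse⇒Injection (Symmetry.inverse B))))

funToFin-cong : ∀ {d p} {f g : Fin d → Fin p} → f ≗ g → Fin.funToFin f ≡ Fin.funToFin g
funToFin-cong {ℕ.zero} _ = ≡.refl
funToFin-cong {ℕ.suc d} f≗g = ≡.cong₂ Fin.combine (f≗g zero) (funToFin-cong (f≗g ∘ suc))

n<m^n : ∀ {m} → 1 < m → ∀ n → n < m ^ n
n<m^n 1<m ℕ.zero = ℕ.s≤s ℕ.z≤n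
n<m^n {m} 1<m (ℕ.suc n) = ℕₚ.≤-<-trans (n<m^n 1<m n)
  (≡.subst (m ^ n <_) (ℕₚ.*-comm (m ^ n) m) (ℕₚ.m<m*n (m ^ n) m {{m^n≢0}} 1<m))
  where
  m^n≢0 : ℕ.NonZero (m ^ n)
  m^n≢0 = ℕₚ.m^n≢0 m n {{ℕ.>-nonZero (ℕₚ.<-trans (ℕ.s≤s ℕ.z≤n) 1<m)}}

-- Finite products of fields

ΠSetoid : (k : ℕ) → (Fin k → Field) → Setoid 0ℓ 0ℓ
ΠSetoid k F = record
  { Carrier = RawRing.Carrier (ΠRaw k F)
  ; _≈_ = RawRing._≈_ (ΠRaw k F)
  ; isEquivalence = record
    { refl = λ i → Fᵢ.refl i
    ; sym = λ x≈y i → Fᵢ.sym i (x≈y i)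
    ; trans = λ x≈y y≈z i → Fᵢ.trans i (x≈y i) (y≈z i) } }
  where module Fᵢ (i : Fin k) = CommutativeRing (proj₁ (F i))

Π-card : ∀ k (F : Fin k → Field) (m : Fin k → ℕ) → (∀ i → HasCard (proj₁ (F i)) (m i)) →
         Inverse (≡.setoid (Fin (∏ k m))) (ΠSetoid k F)
Π-card ℕ.zero F m cards = record
  { to = λ _ () ; from = λ _ → zero ; to-cong = λ _ () ; from-cong = λ _ → ≡.refl
  ; inverse = (λ _ ()) , λ { {zero} _ → ≡.refl } }
Π-card (ℕ.suc k) F m cards = record
  { to = to ; from = from
  ; to-cong = λ { ≡.refl → Setoid.refl (ΠSetoid (ℕ.suc k) F) }
  ; from-cong = from-cong
  ; inverse = (λ { ≡.refl → to-from _ }) , λ {c} y≈c → ≡.trans (from-cong y≈c) (from-to c) }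
  where
  module H = Inverse (cards zero)
  module T = Inverse (Π-card k (F ∘ suc) (m ∘ suc) (cards ∘ suc))
  module P = Inverse (Finₚ.*↔× {m zero} {∏ k (m ∘ suc)})
  module Fᵢ (i : Fin (ℕ.suc k)) = CommutativeRing (proj₁ (F i))
  to : Fin (∏ (ℕ.suc k) m) → Setoid.Carrier (ΠSetoid (ℕ.suc k) F)
  to c zero = H.to (proj₁ (P.to c))
  to c (suc i) = T.to (proj₂ (P.to c)) i
  from : Setoid.Carrier (ΠSetoid (ℕ.suc k) F) → Fin (∏ (ℕ.suc k) m)
  from y = P.from (H.from (y zero) , T.from (y ∘ suc))
  from-cong : ∀ {y y′} → Setoid._≈_ (ΠSetoid (ℕ.suc k) F) y y′ → from y ≡ from y′
  from-cong y≈y′ = ≡.cong P.from (≡.cong₂ _,_ (H.from-cong (y≈y′ zero)) (T.from-cong (y≈y′ ∘ suc)))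
  to-from : ∀ y → Setoid._≈_ (ΠSetoid (ℕ.suc k) F) (to (from y)) y
  to-from y zero = Fᵢ.trans zero
    (Fᵢ.reflexive zero (≡.cong (H.to ∘ proj₁) (P.strictlyInverseˡ _))) (H.strictlyInverseˡ (y zero))
  to-from y (suc i) = Fᵢ.trans (suc i)
    (Fᵢ.reflexive (suc i) (≡.cong (λ r → T.to (proj₂ r) i) (P.strictlyInverseˡ _))) (T.strictlyInverseˡ (y ∘ suc) i)
  from-to : ∀ c → from (to c) ≡ c
  from-to c =
    ≡.trans (≡.cong P.from (≡.cong₂ _,_ (H.strictlyInverseʳ _) (T.strictlyInverseʳ _))) (P.strictlyInverseʳ c)

-- Idempotents and corner rings

module Idempotents {c ℓ} (R : CommutativeRing c ℓ) where
  open CommutativeRing R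
  open Ringₚ ring using (-‿distribʳ-*; x[y-z]≈xy-xz; [y-z]x≈yx-zx)
  open import Relation.Binary.Reasoning.Setoid setoid

  Idempotent : Carrier → Set ℓ
  Idempotent e = e * e ≈ e

  FieldIdempotent : Carrier → Set (c ⊔ ℓ)
  FieldIdempotent f = Idempotent f × ¬ f ≈ 0# × (∀ x → f * x ≈ x → ¬ x ≈ 0# → ∃ λ y → x * y ≈ f)

  -- x ∼[ e ] y identifies x and y modulo the annihilator of e; R/∼[ e ] is the corner ring eR.
  infix 4 _∼[_]_
  _∼[_]_ : Carrier → Carrier → Carrier → Set ℓ
  x ∼[ e ] y = e * x ≈ e * y

  ∼-mono : ∀ {e f x y} → f * e ≈ f → x ∼[ e ] y → x ∼[ f ] y
  ∼-mono {e} {f} {x} {y} fe≈f ex≈ey = begin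
    f * x       ≈⟨ *-congʳ fe≈f ⟨
    f * e * x   ≈⟨ *-assoc f e x ⟩
    f * (e * x) ≈⟨ *-congˡ ex≈ey ⟩
    f * (e * y) ≈⟨ *-assoc f e y ⟨
    f * e * y   ≈⟨ *-congʳ fe≈f ⟩
    f * y       ∎

  module _ (e : Carrier) where
    ∼-reflexive : ∀ {x y} → x ≈ y → x ∼[ e ] y
    ∼-reflexive = *-congˡ

    ∼-+-cong : ∀ {x y u v} → x ∼[ e ] y → u ∼[ e ] v → x + u ∼[ e ] y + v
    ∼-+-cong {x} {y} {u} {v} x∼y u∼v = begin
      e * (x + u)   ≈⟨ distribˡ e x u ⟩
      e * x + e * u ≈⟨ +-cong x∼y u∼v ⟩
      e * y + e * v ≈⟨ distribˡ e y v ⟨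
      e * (y + v)   ∎

    ∼-*-congʳ : ∀ {x y} u → x ∼[ e ] y → x * u ∼[ e ] y * u
    ∼-*-congʳ {x} {y} u x∼y = begin
      e * (x * u) ≈⟨ *-assoc e x u ⟨
      e * x * u   ≈⟨ *-congʳ x∼y ⟩
      e * y * u   ≈⟨ *-assoc e y u ⟩
      e * (y * u) ∎

    ∼-*-cong : ∀ {x y u v} → x ∼[ e ] y → u ∼[ e ] v → x * u ∼[ e ] y * v
    ∼-*-cong {x} {y} {u} {v} x∼y u∼v = begin
      e * (x * u) ≈⟨ ∼-*-congʳ u x∼y ⟩
      e * (y * u) ≈⟨ *-congˡ (*-comm y u) ⟩
      e * (u * y) ≈⟨ ∼-*-congʳ y u∼v ⟩
      e * (v * y) ≈⟨ *-congˡ (*-comm v y) ⟩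
      e * (y * v) ∎

    ∼-neg-cong : ∀ {x y} → x ∼[ e ] y → - x ∼[ e ] - y
    ∼-neg-cong {x} {y} x∼y = begin
      e * - x   ≈⟨ -‿distribʳ-* e x ⟨
      - (e * x) ≈⟨ -‿cong x∼y ⟩
      - (e * y) ≈⟨ -‿distribʳ-* e y ⟩
      e * - y   ∎

    ∼-isCommutativeRing : IsCommutativeRing _∼[ e ]_ _+_ _*_ -_ 0# 1#
    ∼-isCommutativeRing = record
      { isRing = record
        { +-isAbelianGroup = record
          { isGroup = record
            { isMonoid = record
              { isSemigroup = record
                { isMagma = record
                  { isEquivalence = record { refl = refl ; sym = sym ; trans = trans }
                  ; ∙-cong = ∼-+-cong }
                ; assoc = λ x y z → ∼-reflexive (+-assoc x y z) }
              ; identity = (∼-reflexive ∘ +-identityˡ) , (∼-reflexive ∘ +-identityʳ) }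
            ; inverse = (∼-reflexive ∘ -‿inverseˡ) , (∼-reflexive ∘ -‿inverseʳ)
            ; ⁻¹-cong = ∼-neg-cong }
          ; comm = λ x y → ∼-reflexive (+-comm x y) }
        ; *-cong = ∼-*-cong
        ; *-assoc = λ x y z → ∼-reflexive (*-assoc x y z)
        ; *-identity = (∼-reflexive ∘ *-identityˡ) , (∼-reflexive ∘ *-identityʳ)
        ; distrib = (λ x y z → ∼-reflexive (distribˡ x y z)) , (λ x y z → ∼-reflexive (distribʳ x y z)) }
      ; *-comm = λ x y → ∼-reflexive (*-comm x y) }

    ∼-rawRing : RawRing c ℓ
    ∼-rawRing = record
      { Carrier = Carrier ; _≈_ = _∼[ e ]_ ; _+_ = _+_ ; _*_ = _*_ ; -_ = -_ ; 0# = 0# ; 1# = 1# }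

  orthogonal-proj : ∀ {u v} → Idempotent u → u * v ≈ 0# → ∀ a b → u * (u * a + v * b) ≈ u * a
  orthogonal-proj {u} {v} idem uv≈0 a b = begin
    u * (u * a + v * b)         ≈⟨ distribˡ u (u * a) (v * b) ⟩
    u * (u * a) + u * (v * b)   ≈⟨ +-cong (*-assoc u u a) (*-assoc u v b) ⟨
    u * u * a + u * v * b       ≈⟨ +-cong (*-congʳ idem) (*-congʳ uv≈0) ⟩
    u * a + 0# * b              ≈⟨ +-congˡ (zeroˡ b) ⟩
    u * a + 0#                  ≈⟨ +-identityʳ (u * a) ⟩
    u * a                       ∎

  module Complement {e f : Carrier} (e-idem : Idempotent e) (f-idem : Idempotent f) (ef≈f : e * f ≈ f) where
    open Groupₚ +-group using (identityˡ-unique; ε⁻¹≈ε)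
    open AbelianGroupₚ +-abelianGroup using (xyx⁻¹≈y)

    g : Carrier
    g = e - f

    fe≈f : f * e ≈ f
    fe≈f = trans (*-comm f e) ef≈f

    fg≈0 : f * g ≈ 0#
    fg≈0 = begin
      f * (e - f)   ≈⟨ x[y-z]≈xy-xz f e f ⟩
      f * e - f * f ≈⟨ +-cong fe≈f (-‿cong f-idem) ⟩
      f - f         ≈⟨ -‿inverseʳ f ⟩
      0#            ∎

    ge≈g : g * e ≈ g
    ge≈g = begin
      (e - f) * e   ≈⟨ [y-z]x≈yx-zx e e f ⟩
      e * e - f * e ≈⟨ +-cong e-idem (-‿cong fe≈f) ⟩
      e - f         ∎

    g-idem : Idempotent g
    g-idem = begin
      g * (e - f)   ≈⟨ x[y-z]≈xy-xz g e f ⟩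
      g * e - g * f ≈⟨ +-cong ge≈g (-‿cong (trans (*-comm g f) fg≈0)) ⟩
      g - 0#        ≈⟨ +-congˡ ε⁻¹≈ε ⟩
      g + 0#        ≈⟨ +-identityʳ g ⟩
      g             ∎

    eg≈g : e * g ≈ g
    eg≈g = trans (*-comm e g) ge≈g

    e≈f+g : e ≈ f + g
    e≈f+g = begin
      e             ≈⟨ xyx⁻¹≈y f e ⟨
      f + e - f     ≈⟨ +-assoc f e (- f) ⟩
      f + (e - f)   ∎

    g≉e : ¬ f ≈ 0# → ¬ g ≈ e
    g≉e f≉0 g≈e = f≉0 (identityˡ-unique f e (trans (+-congˡ (sym g≈e)) (sym e≈f+g)))

module FiniteRing {c ℓ} (R : CommutativeRing c ℓ) {n : ℕ} (card : HasCard R n) where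
  open CommutativeRing R hiding (zero)
  open Idempotents R
  open Inverse card public using () renaming (to to elem; from to index; from-cong to index-cong)
  open import Relation.Binary.Reasoning.Setoid setoid

  elem-index : ∀ x → elem (index x) ≈ x
  elem-index = Inverse.strictlyInverseˡ card

  index-elem : ∀ j → index (elem j) ≡ j
  index-elem = Inverse.strictlyInverseʳ card

  index-injective : ∀ {x y} → index x ≡ index y → x ≈ y
  index-injective {x} {y} eq = begin
    x              ≈⟨ elem-index x ⟨
    elem (index x) ≡⟨ ≡.cong elem eq ⟩
    elem (index y) ≈⟨ elem-index y ⟩
    y              ∎

  infix 4 _≟_
  _≟_ : Decidable _≈_
  x ≟ y = Dec.map′ index-injective index-cong (index x Finₚ.≟ index y)

  support : Carrier → Fin n → Bool
  support e j = Dec.⌊ e * elem j ≟ elem j ⌋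

  support-intro : ∀ {e j} → e * elem j ≈ elem j → T (support e j)
  support-intro {e} {j} = Dec.fromWitness {a? = e * elem j ≟ elem j}

  support-elim : ∀ {e j} → T (support e j) → e * elem j ≈ elem j
  support-elim {e} {j} = Dec.toWitness {a? = e * elem j ≟ elem j}

  -- A level-0 copy of the corner ring R/∼[ e ] on the indices Fin n: equality is read through
  -- index so that it lands in Set.
  module Corner (e : Carrier) where
    infix 4 _≈₀_
    _≈₀_ : Rel (Fin n) 0ℓ
    a ≈₀ b = index (e * elem a) ≡ index (e * elem b)

    rawRing₀ : RawRing 0ℓ 0ℓ
    rawRing₀ = record
      { Carrier = Fin n ; _≈_ = _≈₀_
      ; _+_ = λ a b → index (elem a + elem b)
      ; _*_ = λ a b → index (elem a * elem b)
      ; -_ = λ a → index (- elem a)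
      ; 0# = index 0# ; 1# = index 1# }

    elem-isRingMonomorphism : RingMorphisms.IsRingMonomorphism rawRing₀ (∼-rawRing e) elem
    elem-isRingMonomorphism = record
      { isRingHomomorphism = record
        { isSemiringHomomorphism = record
          { isNearSemiringHomomorphism = record
            { +-isMonoidHomomorphism = record
              { isMagmaHomomorphism = record
                { isRelHomomorphism = record { cong = index-injective }
                ; homo = λ _ _ → elem-index∼ }
              ; ε-homo = elem-index∼ }
            ; *-homo = λ _ _ → elem-index∼ }
          ; 1#-homo = elem-index∼ }
        ; -‿homo = λ _ → elem-index∼ }
      ; injective = index-cong }
      where
      elem-index∼ : ∀ {x} → elem (index x) ∼[ e ] x
      elem-index∼ = ∼-reflexive e (elem-index _)

    cornerRing : CommutativeRing 0ℓ 0ℓ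
    cornerRing = record
      { isCommutativeRing = RingMonomorphism.isCommutativeRing elem-isRingMonomorphism (∼-isCommutativeRing e) }

    index-∼ : ∀ {x y} → x ∼[ e ] y → index x ≈₀ index y
    index-∼ {x} {y} x∼y = index-cong (begin
      e * elem (index x) ≈⟨ *-congˡ (elem-index x) ⟩
      e * x              ≈⟨ x∼y ⟩
      e * y              ≈⟨ *-congˡ (elem-index y) ⟨
      e * elem (index y) ∎)

    index-≈ : ∀ {x y} → x ≈ y → index x ≈₀ index y
    index-≈ = index-∼ ∘ ∼-reflexive e

    ≈₀-∼ : ∀ {x y} → index x ≈₀ index y → x ∼[ e ] y
    ≈₀-∼ {x} {y} eq = begin
      e * x              ≈⟨ *-congˡ (elem-index x) ⟨
      e * elem (index x) ≈⟨ index-injective eq ⟩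
      e * elem (index y) ≈⟨ *-congˡ (elem-index y) ⟩
      e * y              ∎

    e*-idem : Idempotent e → ∀ x → e * (e * x) ≈ e * x
    e*-idem idem x = trans (sym (*-assoc e e x)) (*-congʳ idem)

    module _ (idem : Idempotent e) where

      cornerCard : HasCard cornerRing (count (support e))
      cornerCard = record
        { to = proj₁ ∘ E.to
        ; from = E.from ∘ project
        ; to-cong = ≡.cong (λ a → index (e * elem (proj₁ (E.to a))))
        ; from-cong = λ eq → ≡.cong E.from (Σ-T-≡ eq)
        ; inverse = (λ { ≡.refl → to-from _ }) , from-to }
        where
        module E = Inverse (Fin-count↔ (support e))
        project : Fin n → Σ[ j ∈ Fin n ] T (support e j)
        project j = index (e * elem j) , support-intro (begin
          e * elem (index (e * elem j)) ≈⟨ *-congˡ (elem-index _) ⟩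
          e * (e * elem j)              ≈⟨ e*-idem idem (elem j) ⟩
          e * elem j                    ≈⟨ elem-index _ ⟨
          elem (index (e * elem j))     ∎)
        to-from : ∀ j → proj₁ (E.to (E.from (project j))) ≈₀ j
        to-from j = ≡.trans (≡.cong (λ a → index (e * elem (proj₁ a))) (E.strictlyInverseˡ (project j)))
                            (index-cong (trans (*-congˡ (elem-index _)) (e*-idem idem (elem j))))
        from-to : ∀ {a j} → j ≈₀ proj₁ (E.to a) → E.from (project j) ≡ a
        from-to {a} eq = ≡.trans (≡.cong E.from (Σ-T-≡ (≡.trans eq fixed)))
                                 (E.strictlyInverseʳ a)
          where
          fixed : index (e * elem (proj₁ (E.to a))) ≡ proj₁ (E.to a)
          fixed = ≡.trans (index-cong (support-elim (proj₂ (E.to a)))) (index-elem _)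

    isField : FieldIdempotent e → IsField cornerRing
    isField (idem , e≉0 , invertible) = 1≉0 , inverse
      where
      1≉0 : ¬ index 1# ≈₀ index 0#
      1≉0 eq = e≉0 (begin
        e      ≈⟨ *-identityʳ e ⟨
        e * 1# ≈⟨ ≈₀-∼ eq ⟩
        e * 0# ≈⟨ zeroʳ e ⟩
        0#     ∎)
      inverse : ∀ a → ¬ a ≈₀ index 0# → ∃ λ b → index (elem a * elem b) ≈₀ index 1#
      inverse a a≉0 = index y , index-∼ (begin
          e * (elem a * elem (index y)) ≈⟨ *-congˡ (*-congˡ (elem-index y)) ⟩
          e * (elem a * y)              ≈⟨ *-assoc e (elem a) y ⟨
          x * y                         ≈⟨ xy≈e ⟩
          e                             ≈⟨ *-identityʳ e ⟨
          e * 1#                        ∎)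
        where
        x = e * elem a
        x≉0 : ¬ x ≈ 0#
        x≉0 x≈0 = a≉0 (index-cong (begin
          e * elem a          ≈⟨ x≈0 ⟩
          0#                  ≈⟨ zeroʳ e ⟨
          e * 0#              ≈⟨ *-congˡ (elem-index 0#) ⟨
          e * elem (index 0#) ∎))
        y = proj₁ (invertible x (e*-idem idem (elem a)) x≉0)
        xy≈e = proj₂ (invertible x (e*-idem idem (elem a)) x≉0)

  -- A product decomposition of the corner eR: φ is a surjective ring homomorphism R → ∏ fields
  -- whose kernel is the annihilator of e.
  record Splitting (e : Carrier) : Set (Level.suc 0ℓ ⊔ c ⊔ ℓ) where
    field
      k : ℕ
      fields : Fin k → Field
      sizes : Fin k → ℕ
      fields-card : ∀ i → HasCard (proj₁ (fields i)) (sizes i)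
      φ : Carrier → RawRing.Carrier (ΠRaw k fields)
    open RawRing (ΠRaw k fields) using ()
      renaming (_≈_ to _≈Π_; _+_ to _+Π_; _*_ to _*Π_; -_ to -Π_; 0# to 0Π; 1# to 1Π)
    field
      +-homo : ∀ x y → φ (x + y) ≈Π φ x +Π φ y
      *-homo : ∀ x y → φ (x * y) ≈Π φ x *Π φ y
      -‿homo : ∀ x → φ (- x) ≈Π -Π φ x
      0#-homo : φ 0# ≈Π 0Π
      1#-homo : φ 1# ≈Π 1Π
      ∼⇒≈Π : ∀ {x y} → x ∼[ e ] y → φ x ≈Π φ y
      ≈Π⇒∼ : ∀ {x y} → φ x ≈Π φ y → x ∼[ e ] y
      surjective : ∀ y → ∃ λ x → φ x ≈Π y

  emptySplitting : ∀ {e} → e ≈ 0# → Splitting e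
  emptySplitting {e} e≈0 = record
    { k = 0 ; fields = λ () ; sizes = λ () ; fields-card = λ () ; φ = λ _ ()
    ; +-homo = λ _ _ () ; *-homo = λ _ _ () ; -‿homo = λ _ () ; 0#-homo = λ () ; 1#-homo = λ ()
    ; ∼⇒≈Π = λ _ () ; ≈Π⇒∼ = λ {x} {y} _ → trans (e*≈0 x) (sym (e*≈0 y))
    ; surjective = λ _ → 0# , λ () }
    where
    e*≈0 : ∀ x → e * x ≈ 0#
    e*≈0 x = trans (*-congʳ e≈0) (zeroˡ x)

  -- e = f + g with fR a field: eR ≅ fR × gR.
  extend : ∀ {e f g} → FieldIdempotent f → Idempotent g → f * e ≈ f → g * e ≈ g → f * g ≈ 0# → e ≈ f + g →
           Splitting g → Splitting e
  extend {e} {f} {g} f-field@(f-idem , _ , _) g-idem fe≈f ge≈g fg≈0 e≈f+g G = record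
    { k = ℕ.suc G.k ; fields = fields ; sizes = sizes ; fields-card = fields-card ; φ = φ
    ; +-homo = λ { x y zero → F.index-≈ (+-cong (sym (elem-index x)) (sym (elem-index y)))
                 ; x y (suc i) → G.+-homo x y i }
    ; *-homo = λ { x y zero → F.index-≈ (*-cong (sym (elem-index x)) (sym (elem-index y)))
                 ; x y (suc i) → G.*-homo x y i }
    ; -‿homo = λ { x zero → F.index-≈ (-‿cong (sym (elem-index x))) ; x (suc i) → G.-‿homo x i }
    ; 0#-homo = λ { zero → ≡.refl ; (suc i) → G.0#-homo i }
    ; 1#-homo = λ { zero → ≡.refl ; (suc i) → G.1#-homo i }
    ; ∼⇒≈Π = λ { x∼y zero → F.index-∼ (∼-mono fe≈f x∼y) ; x∼y (suc i) → G.∼⇒≈Π (∼-mono ge≈g x∼y) i }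
    ; ≈Π⇒∼ = λ φx≈φy → ∼-sum (F.≈₀-∼ (φx≈φy zero)) (G.≈Π⇒∼ (φx≈φy ∘ suc))
    ; surjective = surjective }
    where
    module F = Corner f
    module G = Splitting G
    fields : Fin (ℕ.suc G.k) → Field
    fields zero = F.cornerRing , F.isField f-field
    fields (suc i) = G.fields i
    sizes : Fin (ℕ.suc G.k) → ℕ
    sizes zero = count (support f)
    sizes (suc i) = G.sizes i
    fields-card : ∀ i → HasCard (proj₁ (fields i)) (sizes i)
    fields-card zero = F.cornerCard f-idem
    fields-card (suc i) = G.fields-card i
    φ : Carrier → RawRing.Carrier (ΠRaw (ℕ.suc G.k) fields)
    φ x zero = index x
    φ x (suc i) = G.φ x i
    ∼-sum : ∀ {x y} → f * x ≈ f * y → g * x ≈ g * y → e * x ≈ e * y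
    ∼-sum {x} {y} fx≈fy gx≈gy = begin
      e * x         ≈⟨ *-congʳ e≈f+g ⟩
      (f + g) * x   ≈⟨ distribʳ x f g ⟩
      f * x + g * x ≈⟨ +-cong fx≈fy gx≈gy ⟩
      f * y + g * y ≈⟨ distribʳ y f g ⟨
      (f + g) * y   ≈⟨ *-congʳ e≈f+g ⟨
      e * y         ∎
    surjective : ∀ y → ∃ λ x → RawRing._≈_ (ΠRaw (ℕ.suc G.k) fields) (φ x) y
    surjective y = x , λ { zero → first ; (suc i) → rest-≈ i }
      where
      rest = G.surjective (y ∘ suc)
      x′ = proj₁ rest
      a = elem (y zero)
      x = f * a + g * x′
      gx≈gx′ : g * x ≈ g * x′
      gx≈gx′ = trans (*-congˡ (+-comm (f * a) (g * x′)))
                     (orthogonal-proj g-idem (trans (*-comm g f) fg≈0) x′ a)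
      first : index x F.≈₀ y zero
      first = ≡.trans (F.index-∼ (orthogonal-proj f-idem fg≈0 a x′))
                      (≡.cong (λ j → index (f * elem j)) (index-elem (y zero)))
      rest-≈ : Setoid._≈_ (ΠSetoid G.k G.fields) (G.φ x) (y ∘ suc)
      rest-≈ = Setoid.trans (ΠSetoid G.k G.fields) (G.∼⇒≈Π gx≈gx′) (proj₂ rest)

  Splitting[1]⇒isRingIsomorphism : (S : Splitting 1#) →
    let open Splitting S in RingMorphisms.IsRingIsomorphism rawRing (ΠRaw k fields) φ
  Splitting[1]⇒isRingIsomorphism S = record
    { isRingMonomorphism = record
      { isRingHomomorphism = record
        { isSemiringHomomorphism = record
          { isNearSemiringHomomorphism = record
            { +-isMonoidHomomorphism = record
              { isMagmaHomomorphism = record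
                { isRelHomomorphism = record { cong = ∼⇒≈Π ∘ *-congˡ }
                ; homo = +-homo }
              ; ε-homo = 0#-homo }
            ; *-homo = *-homo }
          ; 1#-homo = 1#-homo }
        ; -‿homo = -‿homo }
      ; injective = λ {x} {y} φx≈φy → trans (sym (*-identityˡ x)) (trans (≈Π⇒∼ φx≈φy) (*-identityˡ y)) }
    ; surjective = λ y → proj₁ (surjective y) , λ z≈x →
        Setoid.trans (ΠSetoid k fields) (∼⇒≈Π (*-congˡ z≈x)) (proj₂ (surjective y)) }
    where open Splitting S

-- Finite meadows

module FiniteMeadow {c ℓ} (M : CommutativeRing c ℓ) {n : ℕ} (card : HasCard M n) (meadow : IsMeadow M) where
  open CommutativeRing M
  open Idempotents M
  open FiniteRing M card
  open import Relation.Binary.Reasoning.Setoid setoid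

  infix 8 _⁻¹
  _⁻¹ : Carrier → Carrier
  x ⁻¹ = proj₁ (meadow x)

  x*x*x⁻¹≈x : ∀ x → x * x * x ⁻¹ ≈ x
  x*x*x⁻¹≈x x = proj₁ (proj₂ (meadow x))

  x*x⁻¹-idempotent : ∀ x → Idempotent (x * x ⁻¹)
  x*x⁻¹-idempotent x = begin
    x * x ⁻¹ * (x * x ⁻¹) ≈⟨ *-assoc x (x ⁻¹) (x * x ⁻¹) ⟩
    x * (x ⁻¹ * (x * x ⁻¹)) ≈⟨ *-congˡ (x∙yz≈y∙xz (x ⁻¹) x (x ⁻¹)) ⟩
    x * (x * (x ⁻¹ * x ⁻¹)) ≈⟨ *-assoc x x (x ⁻¹ * x ⁻¹) ⟨
    x * x * (x ⁻¹ * x ⁻¹)   ≈⟨ *-assoc (x * x) (x ⁻¹) (x ⁻¹) ⟨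
    x * x * x ⁻¹ * x ⁻¹     ≈⟨ *-congʳ (x*x*x⁻¹≈x x) ⟩
    x * x ⁻¹                ∎
    where open CommutativeSemigroupₚ *-commutativeSemigroup using (x∙yz≈y∙xz)

  x*x⁻¹≉0 : ∀ {x} → ¬ x ≈ 0# → ¬ x * x ⁻¹ ≈ 0#
  x*x⁻¹≉0 {x} x≉0 xx⁻¹≈0 = x≉0 (begin
    x              ≈⟨ x*x*x⁻¹≈x x ⟨
    x * x * x ⁻¹   ≈⟨ *-assoc x x (x ⁻¹) ⟩
    x * (x * x ⁻¹) ≈⟨ *-congˡ xx⁻¹≈0 ⟩
    x * 0#         ≈⟨ zeroʳ x ⟩
    0#             ∎)

  rank : Carrier → ℕ
  rank e = count (support e)

  infix 4 _⊏_
  _⊏_ : Rel Carrier 0ℓ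
  _⊏_ = _<_ on rank

  ⊏-wellFounded : WellFounded _⊏_
  ⊏-wellFounded = On.wellFounded rank <-wellFounded

  below⇒⊏ : ∀ {e f} → Idempotent e → e * f ≈ f → ¬ f ≈ e → f ⊏ e
  below⇒⊏ {e} {f} idem ef≈f f≉e =
    count-< (support f) (support e) f⊆e (index e) e-fixes-e (f≉e ∘ f-fixes-e)
    where
    f⊆e : ∀ j → T (support f j) → T (support e j)
    f⊆e j fj = support-intro (begin
      e * elem j       ≈⟨ *-congˡ (support-elim fj) ⟨
      e * (f * elem j) ≈⟨ *-assoc e f (elem j) ⟨
      e * f * elem j   ≈⟨ *-congʳ ef≈f ⟩
      f * elem j       ≈⟨ support-elim fj ⟩
      elem j           ∎)
    e-fixes-e : T (support e (index e))
    e-fixes-e = support-intro (trans (*-congˡ (elem-index e)) (trans idem (sym (elem-index e))))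
    f-fixes-e : T (support f (index e)) → f ≈ e
    f-fixes-e fe = begin
      f                  ≈⟨ ef≈f ⟨
      e * f              ≈⟨ *-comm e f ⟩
      f * e              ≈⟨ *-congˡ (elem-index e) ⟨
      f * elem (index e) ≈⟨ support-elim fe ⟩
      elem (index e)     ≈⟨ elem-index e ⟩
      e                  ∎

  Splits : Carrier → Fin n → Set ℓ
  Splits e j = e * elem j ≈ elem j × ¬ elem j ≈ 0# × ¬ elem j * elem j ⁻¹ ≈ e

  splits? : ∀ e j → Dec (Splits e j)
  splits? e j = (e * elem j ≟ elem j) ×-dec ¬? (elem j ≟ 0#) ×-dec ¬? (elem j * elem j ⁻¹ ≟ e)

  -- A nonzero x ∈ eR with x x⁻¹ ≠ e yields the strictly smaller idempotent x x⁻¹; when there is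
  -- none, every nonzero x ∈ eR has x x⁻¹ = e, so eR is a field.
  fieldIdempotent-below : ∀ e → Acc _⊏_ e → Idempotent e → ¬ e ≈ 0# → ∃ λ f → FieldIdempotent f × e * f ≈ f
  fieldIdempotent-below e (acc rs) idem e≉0 with Finₚ.any? (splits? e)
  ... | no ¬split = e , (idem , e≉0 , invertible) , idem
    where
    invertible : ∀ x → e * x ≈ x → ¬ x ≈ 0# → ∃ λ y → x * y ≈ e
    invertible x ex≈x x≉0 = elem j ⁻¹ , trans (*-congʳ (sym (elem-index x))) jj⁻¹≈e
      where
      j = index x
      jj⁻¹≈e : elem j * elem j ⁻¹ ≈ e
      jj⁻¹≈e = Dec.decidable-stable (elem j * elem j ⁻¹ ≟ e) λ jj⁻¹≉e →
        ¬split (j , trans (*-congˡ (elem-index x)) (trans ex≈x (sym (elem-index x))) ,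
                    x≉0 ∘ trans (sym (elem-index x)) , jj⁻¹≉e)
  ... | yes (j , ej≈j , j≉0 , jj⁻¹≉e) =
    let (f , fieldIdem , e′f≈f) = fieldIdempotent-below e′ (rs e′⊏e) (x*x⁻¹-idempotent x) (x*x⁻¹≉0 j≉0)
    in f , fieldIdem , (begin
      e * f        ≈⟨ *-congˡ e′f≈f ⟨
      e * (e′ * f) ≈⟨ *-assoc e e′ f ⟨
      e * e′ * f   ≈⟨ *-congʳ ee′≈e′ ⟩
      e′ * f       ≈⟨ e′f≈f ⟩
      f            ∎)
    where
    x = elem j
    e′ = x * x ⁻¹
    ee′≈e′ : e * e′ ≈ e′
    ee′≈e′ = trans (sym (*-assoc e x (x ⁻¹))) (*-congʳ ej≈j)
    e′⊏e : e′ ⊏ e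
    e′⊏e = below⇒⊏ idem ee′≈e′ jj⁻¹≉e

  split : ∀ e → Acc _⊏_ e → Idempotent e → Splitting e
  split e (acc rs) idem with e ≟ 0#
  ... | yes e≈0 = emptySplitting e≈0
  ... | no e≉0 =
    let (f , f-field@(f-idem , f≉0 , _) , ef≈f) = fieldIdempotent-below e (acc rs) idem e≉0
        open Complement idem f-idem ef≈f
    in extend f-field g-idem fe≈f ge≈g fg≈0 e≈f+g (split g (rs (below⇒⊏ idem eg≈g (g≉e f≉0))) g-idem)

  splitting : Splitting 1#
  splitting = split 1# (⊏-wellFounded 1#) (*-identityˡ 1#)

-- Finite fields

record PrimePower (m : ℕ) : Set where
  field
    prime exponent : ℕ
    isPrime : Prime prime
    1≤exponent : 1 ≤ exponent
    m≡prime^exponent : m ≡ prime ^ exponent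

module FiniteField {a b} (F : CommutativeRing a b) (isField : IsField F) {m : ℕ} (card : HasCard F m) where
  open CommutativeRing F hiding (zero)
  open FiniteRing F card using (elem; index; elem-index; index-elem; index-cong; index-injective; _≟_)
  open SemiringMult semiring using (×-homo-+; ×1-homo-*) renaming (_×_ to _·_)
  open Groupₚ +-group using (inverseʳ-unique; ∙-cancelˡ; x≈z//y; ⁻¹-involutive)
  open Ringₚ ring using (-‿distribˡ-*; [y-z]x≈yx-zx)
  open MonoidSum +-monoid using (sum; sum-cong-≗)
  open import Relation.Binary.Reasoning.Setoid setoid

  ι : ℕ → Carrier
  ι k = k · 1#

  ι-+ : ∀ j k → ι (j ℕ.+ k) ≈ ι j + ι k
  ι-+ = ×-homo-+ 1#

  ι-* : ∀ j k → ι (j ℕ.* k) ≈ ι j * ι k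
  ι-* = ×1-homo-*

  ι-1 : ι 1 ≈ 1#
  ι-1 = +-identityʳ 1#

  1≉0 : ¬ 1# ≈ 0#
  1≉0 = proj₁ isField

  integral : ∀ {x y} → x * y ≈ 0# → x ≈ 0# ⊎ y ≈ 0#
  integral {x} {y} xy≈0 with x ≟ 0#
  ... | yes x≈0 = inj₁ x≈0
  ... | no x≉0 = let (u , xu≈1) = proj₂ isField x x≉0 in inj₂ (begin
    y           ≈⟨ *-identityˡ y ⟨
    1# * y      ≈⟨ *-congʳ xu≈1 ⟨
    x * u * y   ≈⟨ xy∙z≈y∙xz x u y ⟩
    u * (x * y) ≈⟨ *-congˡ xy≈0 ⟩
    u * 0#      ≈⟨ zeroʳ u ⟩
    0#          ∎)
    where open CommutativeSemigroupₚ *-commutativeSemigroup using (xy∙z≈y∙xz)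

  -- Two of the m + 1 elements ι 0, …, ι m coincide.
  positive-characteristic : ∃ λ N → ι (ℕ.suc N) ≈ 0#
  positive-characteristic with Finₚ.pigeonhole (ℕₚ.n<1+n m) (λ (i : Fin (ℕ.suc m)) → index (ι (Fin.toℕ i)))
  ... | i , j , i<j , eq = N , identityʳ-unique (ι (Fin.toℕ i)) (ι (ℕ.suc N)) (begin
    ι (Fin.toℕ i) + ι (ℕ.suc N)    ≈⟨ ι-+ (Fin.toℕ i) (ℕ.suc N) ⟨
    ι (Fin.toℕ i ℕ.+ ℕ.suc N)      ≡⟨ ≡.cong ι i+N+1≡j ⟩
    ι (Fin.toℕ j)                  ≈⟨ index-injective eq ⟨
    ι (Fin.toℕ i)                  ∎)
    where
    open Groupₚ +-group using (identityʳ-unique)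
    N = Fin.toℕ j ℕ.∸ ℕ.suc (Fin.toℕ i)
    i+N+1≡j : Fin.toℕ i ℕ.+ ℕ.suc N ≡ Fin.toℕ j
    i+N+1≡j = ≡.trans (ℕₚ.+-suc (Fin.toℕ i) N) (ℕₚ.m+[n∸m]≡n i<j)

  prime-characteristic : ∃ λ p → Prime p × ι p ≈ 0#
  prime-characteristic =
    let (N , ιN≈0) = positive-characteristic
        open PrimeFactorisation (factorise (ℕ.suc N))
    in vanishing-factor factorsPrime (trans (reflexive (≡.cong ι (≡.sym isFactorisation))) ιN≈0)
    where
    vanishing-factor : ∀ {ps} → All Prime ps → ι (product ps) ≈ 0# → ∃ λ p → Prime p × ι p ≈ 0#
    vanishing-factor [] ι1≈0 = ⊥-elim (1≉0 (trans (sym ι-1) ι1≈0))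
    vanishing-factor {p ∷ ps} (p-prime ∷ ps-prime) ιp*ps≈0 with integral (trans (sym (ι-* p _)) ιp*ps≈0)
    ... | inj₁ ιp≈0 = p , p-prime , ιp≈0
    ... | inj₂ ιps≈0 = vanishing-factor ps-prime ιps≈0

  module PrimeField {p : ℕ} (p-prime : Prime p) (ιp≈0 : ι p ≈ 0#) where
    private instance
      p-nonZero : ℕ.NonZero p
      p-nonZero = prime⇒nonZero p-prime

    ι-p* : ∀ k → ι (p ℕ.* k) ≈ 0#
    ι-p* k = trans (ι-* p k) (trans (*-congʳ ιp≈0) (zeroˡ (ι k)))

    reduce : ℕ → Fin p
    reduce k = Fin.fromℕ< (m%n<n k p)

    ι-reduce : ∀ k → ι (Fin.toℕ (reduce k)) ≈ ι k
    ι-reduce k = begin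
      ι (Fin.toℕ (reduce k))        ≡⟨ ≡.cong ι (Finₚ.toℕ-fromℕ< (m%n<n k p)) ⟩
      ι (k % p)                     ≈⟨ +-identityʳ (ι (k % p)) ⟨
      ι (k % p) + 0#                ≈⟨ +-congˡ (ι-p* (k / p)) ⟨
      ι (k % p) + ι (p ℕ.* (k / p)) ≈⟨ ι-+ (k % p) _ ⟨
      ι (k % p ℕ.+ p ℕ.* (k / p))   ≡⟨ ≡.cong (λ r → ι (k % p ℕ.+ r)) (ℕₚ.*-comm p (k / p)) ⟩
      ι (k % p ℕ.+ k / p ℕ.* p)     ≡⟨ ≡.cong ι (m≡m%n+[m/n]*n k p) ⟨
      ι k                           ∎

    ι-[p∸1]* : ∀ k → ι ((p ℕ.∸ 1) ℕ.* k) ≈ - ι k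
    ι-[p∸1]* k = inverseʳ-unique (ι k) _ (begin
      ι k + ι ((p ℕ.∸ 1) ℕ.* k) ≈⟨ ι-+ k _ ⟨
      ι ((1 ℕ.+ (p ℕ.∸ 1)) ℕ.* k) ≡⟨ ≡.cong (λ r → ι (r ℕ.* k)) (ℕₚ.m+[n∸m]≡n (ℕ.>-nonZero⁻¹ p)) ⟩
      ι (p ℕ.* k)                 ≈⟨ ι-p* k ⟩
      0#                          ∎)

    -- Bézout for the coprime pair (p, d).
    ι-inverse : ∀ d → .{{ℕ.NonZero d}} → d < p → ∃ λ t → ι t * ι d ≈ 1#
    ι-inverse d d<p with coprime-Bézout (prime⇒coprime p-prime d<p)
    ... | Bézout.-+ x y 1+xp≡yd = y , (begin
      ι y * ι d           ≈⟨ ι-* y d ⟨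
      ι (y ℕ.* d)         ≡⟨ ≡.cong ι 1+xp≡yd ⟨
      ι (1 ℕ.+ x ℕ.* p)   ≈⟨ ι-+ 1 (x ℕ.* p) ⟩
      ι 1 + ι (x ℕ.* p)   ≈⟨ +-cong ι-1 (trans (reflexive (≡.cong ι (ℕₚ.*-comm x p))) (ι-p* x)) ⟩
      1# + 0#             ≈⟨ +-identityʳ 1# ⟩
      1#                  ∎)
    ... | Bézout.+- x y 1+yd≡xp = (p ℕ.∸ 1) ℕ.* y , (begin
      ι ((p ℕ.∸ 1) ℕ.* y) * ι d ≈⟨ *-congʳ (ι-[p∸1]* y) ⟩
      - ι y * ι d               ≈⟨ -‿distribˡ-* (ι y) (ι d) ⟨
      - (ι y * ι d)             ≈⟨ -‿cong yd≈-1 ⟩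
      - - 1#                    ≈⟨ ⁻¹-involutive 1# ⟩
      1#                        ∎)
      where
      yd≈-1 : ι y * ι d ≈ - 1#
      yd≈-1 = inverseʳ-unique 1# (ι y * ι d) (begin
        1# + ι y * ι d       ≈⟨ +-cong ι-1 (ι-* y d) ⟨
        ι 1 + ι (y ℕ.* d)    ≈⟨ ι-+ 1 (y ℕ.* d) ⟨
        ι (1 ℕ.+ y ℕ.* d)    ≡⟨ ≡.cong ι 1+yd≡xp ⟩
        ι (x ℕ.* p)          ≡⟨ ≡.cong ι (ℕₚ.*-comm x p) ⟩
        ι (p ℕ.* x)          ≈⟨ ι-p* x ⟩
        0#                   ∎)

    scalar : Fin p → Carrier
    scalar a = ι (Fin.toℕ a)

    combination : ∀ {d} → (Fin d → Fin p) → (Fin d → Carrier) → Carrier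
    combination c v = sum (λ i → scalar (c i) * v i)

    InSpan : ∀ {d} → (Fin d → Carrier) → Carrier → Set b
    InSpan v x = ∃ λ c → combination c v ≈ x

    Independent : ∀ {d} → (Fin d → Carrier) → Set b
    Independent v = ∀ c c′ → combination c v ≈ combination c′ v → c ≗ c′

    combination-cong : ∀ {d} {c c′ : Fin d → Fin p} v → c ≗ c′ → combination c v ≡ combination c′ v
    combination-cong v c≗c′ = sum-cong-≗ (λ i → ≡.cong (λ a → scalar a * v i) (c≗c′ i))

    span-difference : ∀ t {d} (v : Fin d → Carrier) c c′ → InSpan v (ι t * (combination c′ v - combination c v))
    span-difference t {ℕ.zero} v c c′ = (λ ()) , sym (trans (*-congˡ (-‿inverseʳ 0#)) (zeroʳ (ι t)))
    span-difference t {ℕ.suc d} v c c′ =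
      let (c″ , c″≈) = span-difference t (v ∘ suc) (c ∘ suc) (c′ ∘ suc)
      in (reduce N Vector.∷ c″) , (begin
        scalar (reduce N) * v zero + combination c″ (v ∘ suc)
          ≈⟨ +-cong (*-congʳ head≈) c″≈ ⟩
        ι t * (scalar (c′ zero) - scalar (c zero)) * v zero + ι t * (C′ - C)
          ≈⟨ +-congʳ (*-assoc (ι t) _ (v zero)) ⟩
        ι t * ((scalar (c′ zero) - scalar (c zero)) * v zero) + ι t * (C′ - C)
          ≈⟨ distribˡ (ι t) _ _ ⟨
        ι t * ((scalar (c′ zero) - scalar (c zero)) * v zero + (C′ - C))
          ≈⟨ *-congˡ (+-congʳ ([y-z]x≈yx-zx (v zero) _ _)) ⟩
        ι t * ((scalar (c′ zero) * v zero - scalar (c zero) * v zero) + (C′ - C))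
          ≈⟨ *-congˡ (+-interchange _ _ _ _) ⟩
        ι t * ((scalar (c′ zero) * v zero + C′) + (- (scalar (c zero) * v zero) + - C))
          ≈⟨ *-congˡ (+-congˡ (⁻¹-∙-comm _ C)) ⟩
        ι t * ((scalar (c′ zero) * v zero + C′) - (scalar (c zero) * v zero + C)) ∎)
      where
      open CommutativeSemigroupₚ +-commutativeSemigroup using () renaming (interchange to +-interchange)
      open AbelianGroupₚ +-abelianGroup using (⁻¹-∙-comm)
      C = combination (c ∘ suc) (v ∘ suc)
      C′ = combination (c′ ∘ suc) (v ∘ suc)
      N = t ℕ.* (Fin.toℕ (c′ zero) ℕ.+ (p ℕ.∸ 1) ℕ.* Fin.toℕ (c zero))
      head≈ : scalar (reduce N) ≈ ι t * (scalar (c′ zero) - scalar (c zero))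
      head≈ = begin
        scalar (reduce N) ≈⟨ ι-reduce N ⟩
        ι N               ≈⟨ ι-* t _ ⟩
        ι t * ι (Fin.toℕ (c′ zero) ℕ.+ (p ℕ.∸ 1) ℕ.* Fin.toℕ (c zero))
                          ≈⟨ *-congˡ (trans (ι-+ (Fin.toℕ (c′ zero)) _) (+-congˡ (ι-[p∸1]* (Fin.toℕ (c zero))))) ⟩
        ι t * (scalar (c′ zero) - scalar (c zero)) ∎

    -- If a ≠ a′ then (a - a′) w lies in the span, and a - a′ is invertible in ℤ/p.
    inSpan-by-difference : ∀ {d} {v : Fin d → Carrier} {w} a a′ c c′ → Fin.toℕ a′ < Fin.toℕ a →
      scalar a * w + combination c v ≈ scalar a′ * w + combination c′ v → InSpan v w
    inSpan-by-difference {v = v} {w} a a′ c c′ a′<a eq =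
      let (c″ , c″≈) = span-difference t v c c′ in c″ , trans c″≈ (sym w≈)
      where
      C = combination c v
      C′ = combination c′ v
      δ = Fin.toℕ a ℕ.∸ Fin.toℕ a′
      instance
        δ-nonZero : ℕ.NonZero δ
        δ-nonZero = ℕ.>-nonZero (ℕₚ.m<n⇒0<n∸m a′<a)
      δ<p : δ < p
      δ<p = ℕₚ.≤-<-trans (ℕₚ.m∸n≤m (Fin.toℕ a) (Fin.toℕ a′)) (Finₚ.toℕ<n a)
      t = proj₁ (ι-inverse δ δ<p)
      δw+C≈C′ : ι δ * w + C ≈ C′
      δw+C≈C′ = ∙-cancelˡ (scalar a′ * w) _ _ (begin
        scalar a′ * w + (ι δ * w + C) ≈⟨ +-assoc _ _ C ⟨
        scalar a′ * w + ι δ * w + C   ≈⟨ +-congʳ (distribʳ w _ _) ⟨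
        (scalar a′ + ι δ) * w + C     ≈⟨ +-congʳ (*-congʳ (ι-+ (Fin.toℕ a′) δ)) ⟨
        ι (Fin.toℕ a′ ℕ.+ δ) * w + C  ≡⟨ ≡.cong (λ k → ι k * w + C) (ℕₚ.m+[n∸m]≡n (ℕₚ.<⇒≤ a′<a)) ⟩
        scalar a * w + C              ≈⟨ eq ⟩
        scalar a′ * w + C′            ∎)
      w≈ : w ≈ ι t * (C′ - C)
      w≈ = begin
        w               ≈⟨ *-identityˡ w ⟨
        1# * w          ≈⟨ *-congʳ (proj₂ (ι-inverse δ δ<p)) ⟨
        ι t * ι δ * w   ≈⟨ *-assoc (ι t) (ι δ) w ⟩
        ι t * (ι δ * w) ≈⟨ *-congˡ (x≈z//y _ C C′ δw+C≈C′) ⟩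
        ι t * (C′ - C)  ∎

    independent-∷ : ∀ {d} {v : Fin d → Carrier} {w} → Independent v → ¬ InSpan v w → Independent (w Vector.∷ v)
    independent-∷ {v = v} {w} ind w∉ c c′ eq = λ { zero → heads ; (suc i) → ind (c ∘ suc) (c′ ∘ suc) tails i }
      where
      heads : c zero ≡ c′ zero
      heads with ℕₚ.<-cmp (Fin.toℕ (c zero)) (Fin.toℕ (c′ zero))
      ... | tri< lt _ _ = ⊥-elim (w∉ (inSpan-by-difference (c′ zero) (c zero) (c′ ∘ suc) (c ∘ suc) lt (sym eq)))
      ... | tri≈ _ eq₀ _ = Finₚ.toℕ-injective eq₀
      ... | tri> _ _ gt = ⊥-elim (w∉ (inSpan-by-difference (c zero) (c′ zero) (c ∘ suc) (c′ ∘ suc) gt eq))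
      tails : combination (c ∘ suc) v ≈ combination (c′ ∘ suc) v
      tails = ∙-cancelˡ (scalar (c zero) * w) _ _
        (trans eq (+-congʳ (*-congʳ (reflexive (≡.cong scalar (≡.sym heads))))))

    independent⇒≤ : ∀ {d} {v : Fin d → Carrier} → Independent v → p ^ d ≤ m
    independent⇒≤ {d} {v} ind =
      Finₚ.injective⇒≤ {f = λ k → index (combination (Fin.finToFun k) v)} λ {k} {k′} eq →
      ≡.trans (≡.sym (Finₚ.funToFin-finToFin {d} {p} k))
        (≡.trans (funToFin-cong (ind (Fin.finToFun k) (Fin.finToFun k′) (index-injective eq)))
                 (Finₚ.funToFin-finToFin {d} {p} k′))

    spans⇒≥ : ∀ {d} (v : Fin d → Carrier) → (∀ x → InSpan v x) → m ≤ p ^ d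
    spans⇒≥ v spans = Finₚ.injective⇒≤ {f = λ j → Fin.funToFin (coeffs j)} λ {j} {j′} eq →
      ≡.trans (≡.sym (index-elem j)) (≡.trans (index-cong (begin
        elem j                    ≈⟨ proj₂ (spans (elem j)) ⟨
        combination (coeffs j) v  ≡⟨ combination-cong v (coeffs≗ eq) ⟩
        combination (coeffs j′) v ≈⟨ proj₂ (spans (elem j′)) ⟩
        elem j′                   ∎)) (index-elem j′))
      where
      coeffs : Fin m → Fin _ → Fin p
      coeffs j = proj₁ (spans (elem j))
      coeffs≗ : ∀ {j j′} → Fin.funToFin (coeffs j) ≡ Fin.funToFin (coeffs j′) → coeffs j ≗ coeffs j′
      coeffs≗ {j} {j′} eq i = ≡.trans (≡.sym (Finₚ.finToFun-funToFin (coeffs j) i))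
        (≡.trans (≡.cong (λ k → Fin.finToFun k i) eq) (Finₚ.finToFun-funToFin (coeffs j′) i))

    inSpan? : ∀ {d} (v : Fin d → Carrier) x → Dec (InSpan v x)
    inSpan? v x = Dec.map′ (λ (k , h) → Fin.finToFun k , h)
      (λ (c , h) → Fin.funToFin c , trans (reflexive (combination-cong v (Finₚ.finToFun-funToFin c))) h)
      (Finₚ.any? λ k → combination (Fin.finToFun k) v ≟ x)

    -- Extending an independent family by vectors outside its span must stop, since p ^ d ≤ m.
    basis-dimension : ∀ k {d} (v : Fin d → Carrier) → Independent v → m ≤ k ℕ.+ d → ∃ λ e → m ≡ p ^ e
    basis-dimension k {d} v ind m≤k+d with Finₚ.any? (λ j → ¬? (inSpan? v (elem j)))
    ... | no all-in = d , ℕₚ.≤-antisym (spans⇒≥ v spans) (independent⇒≤ ind)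
      where
      spans : ∀ x → InSpan v x
      spans x = let (c , h) = Dec.decidable-stable (inSpan? v (elem (index x))) (λ ∉ → all-in (index x , ∉))
                in c , trans h (elem-index x)
    basis-dimension ℕ.zero {d} v ind m≤d | yes (j , j∉) =
      ⊥-elim (ℕₚ.<⇒≱ (n<m^n 1<p (ℕ.suc d))
        (ℕₚ.≤-trans (independent⇒≤ {v = elem j Vector.∷ v} (independent-∷ ind j∉)) (ℕₚ.m≤n⇒m≤1+n m≤d)))
      where 1<p = ℕ.nonTrivial⇒n>1 p {{prime⇒nonTrivial p-prime}}
    basis-dimension (ℕ.suc k) {d} v ind m≤k+d | yes (j , j∉) =
      basis-dimension k (elem j Vector.∷ v) (independent-∷ ind j∉) (≡.subst (m ≤_) (≡.sym (ℕₚ.+-suc k d)) m≤k+d)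

  m≢1 : ¬ m ≡ 1
  m≢1 m≡1 = 1≉0 (index-injective (Fin1-unique m≡1 (index 1#) (index 0#)))
    where
    Fin1-unique : ∀ {k} → k ≡ 1 → (i j : Fin k) → i ≡ j
    Fin1-unique ≡.refl zero zero = ≡.refl

  primePower : PrimePower m
  primePower =
    let (p , p-prime , ιp≈0) = prime-characteristic
        open PrimeField p-prime ιp≈0
        (e , m≡p^e) = basis-dimension m (λ ()) (λ _ _ _ ()) (ℕₚ.m≤m+n m 0)
    in record
      { prime = p ; exponent = e ; isPrime = p-prime ; 1≤exponent = 1≤e e m≡p^e ; m≡prime^exponent = m≡p^e }
    where
    1≤e : ∀ {p} e → m ≡ p ^ e → 1 ≤ e
    1≤e ℕ.zero m≡1 = ⊥-elim (m≢1 m≡1)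
    1≤e (ℕ.suc e) _ = ℕ.s≤s ℕ.z≤n

-- Products of fields are meadows

field⇒meadow : ∀ {a b} (F : CommutativeRing a b) → IsField F → Decidable (CommutativeRing._≈_ F) → IsMeadow F
field⇒meadow F (_ , invertible) _≟_ x = generalizedInverse (x ≟ 0#)
  where
  open CommutativeRing F
  generalizedInverse : Dec (x ≈ 0#) → ∃ λ y → (x * x * y ≈ x) × (y * y * x ≈ y)
  generalizedInverse (yes x≈0) = 0# , trans (zeroʳ (x * x)) (sym x≈0) , trans (*-congʳ (zeroʳ 0#)) (zeroˡ x)
  generalizedInverse (no x≉0) = let (u , xu≈1) = invertible x x≉0 in
    u , trans (*-assoc x x u) (trans (*-congˡ xu≈1) (*-identityʳ x))
      , trans (*-assoc u u x) (trans (*-congˡ (trans (*-comm u x) xu≈1)) (*-identityʳ u))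

module RingIsomorphism {c ℓ} (M : CommutativeRing c ℓ) {k} (F : Fin k → Field) {φ}
    (iso : RingMorphisms.IsRingIsomorphism (CommutativeRing.rawRing M) (ΠRaw k F) φ) where
  open CommutativeRing M using (setoid; _*_)
  open RingMorphisms.IsRingIsomorphism iso
  open Setoid (ΠSetoid k F) using () renaming (_≈_ to _≈Π_; refl to Πrefl; sym to Πsym; trans to Πtrans)
  open RawRing (ΠRaw k F) using () renaming (_*_ to _*Π_)
  module Fᵢ (i : Fin k) = CommutativeRing (proj₁ (F i))

  ψ : Setoid.Carrier (ΠSetoid k F) → CommutativeRing.Carrier M
  ψ y = proj₁ (surjective y)

  φψ : ∀ y → φ (ψ y) ≈Π y
  φψ y = proj₂ (surjective y) (CommutativeRing.refl M)

  φ-injection : Injection setoid (ΠSetoid k F)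
  φ-injection = record { to = φ ; cong = ⟦⟧-cong ; injective = injective }

  ψ-injection : Injection (ΠSetoid k F) setoid
  ψ-injection = record
    { to = ψ
    ; cong = λ {y} {y′} y≈y′ → injective (Πtrans (φψ y) (Πtrans y≈y′ (Πsym (φψ y′))))
    ; injective = λ {y} {y′} ψy≈ψy′ → Πtrans (Πsym (φψ y)) (Πtrans (⟦⟧-cong ψy≈ψy′) (φψ y′)) }

  card-≡ : ∀ {n N} → HasCard M n → Inverse (≡.setoid (Fin N)) (ΠSetoid k F) → n ≡ N
  card-≡ cardM cardΠ =
    ℕₚ.≤-antisym (injection⇒≤ cardM cardΠ φ-injection) (injection⇒≤ cardΠ cardM ψ-injection)

  *Π-cong : ∀ {a a′ b b′} → a ≈Π a′ → b ≈Π b′ → a *Π b ≈Π a′ *Π b′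
  *Π-cong a≈a′ b≈b′ i = Fᵢ.*-cong i (a≈a′ i) (b≈b′ i)

  meadow : (∀ i → IsMeadow (proj₁ (F i))) → IsMeadow M
  meadow meadows x = ψ y , injective xxψy≈x , injective ψyψyx≈ψy
    where
    open import Relation.Binary.Reasoning.Setoid (ΠSetoid k F)
    y : Setoid.Carrier (ΠSetoid k F)
    y i = proj₁ (meadows i (φ x i))
    xxψy≈x : φ (x * x * ψ y) ≈Π φ x
    xxψy≈x = begin
      φ (x * x * ψ y)      ≈⟨ *-homo (x * x) (ψ y) ⟩
      φ (x * x) *Π φ (ψ y) ≈⟨ *Π-cong (*-homo x x) (φψ y) ⟩
      φ x *Π φ x *Π y      ≈⟨ (λ i → proj₁ (proj₂ (meadows i (φ x i)))) ⟩
      φ x                  ∎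
    ψyψyx≈ψy : φ (ψ y * ψ y * x) ≈Π φ (ψ y)
    ψyψyx≈ψy = begin
      φ (ψ y * ψ y * x)         ≈⟨ *-homo (ψ y * ψ y) x ⟩
      φ (ψ y * ψ y) *Π φ x      ≈⟨ *Π-cong (*-homo (ψ y) (ψ y)) Πrefl ⟩
      φ (ψ y) *Π φ (ψ y) *Π φ x ≈⟨ *Π-cong (*Π-cong (φψ y) (φψ y)) Πrefl ⟩
      y *Π y *Π φ x             ≈⟨ (λ i → proj₂ (proj₂ (meadows i (φ x i)))) ⟩
      y                         ≈⟨ φψ y ⟨
      φ (ψ y)                   ∎

PrimePowerFieldDecomposition : ∀ {c ℓ} → CommutativeRing c ℓ → ℕ → Set (Level.suc 0ℓ ⊔ c ⊔ ℓ)
PrimePowerFieldDecomposition M n =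
  Σ ℕ λ k → Σ (Fin k → ℕ) λ p → Σ (Fin k → ℕ) λ e → Σ (Fin k → Field) λ F →
    (∀ i → Prime (p i)) × (∀ i → 1 ≤ e i) × (∀ i → HasCard (proj₁ (F i)) (p i ^ e i))
    × (∃ λ φ → RingMorphisms.IsRingIsomorphism (CommutativeRing.rawRing M) (ΠRaw k F) φ)
    × (n ≡ ∏ k (λ i → p i ^ e i))

finiteMeadow⇒decomposition : ∀ {c ℓ} (M : CommutativeRing c ℓ) {n} → HasCard M n → IsMeadow M →
                             PrimePowerFieldDecomposition M n
finiteMeadow⇒decomposition M card meadow =
  k , P.prime , P.exponent , fields , P.isPrime , P.1≤exponent , cards , (φ , iso) ,
  RingIsomorphism.card-≡ M fields iso card (Π-card k fields (λ i → P.prime i ^ P.exponent i) cards)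
  where
  splitting = FiniteMeadow.splitting M card meadow
  open FiniteRing.Splitting splitting
  module P (i : Fin k) = PrimePower (FiniteField.primePower (proj₁ (fields i)) (proj₂ (fields i)) (fields-card i))
  cards : ∀ i → HasCard (proj₁ (fields i)) (P.prime i ^ P.exponent i)
  cards i = ≡.subst (HasCard (proj₁ (fields i))) (P.m≡prime^exponent i) (fields-card i)
  iso : RingMorphisms.IsRingIsomorphism (CommutativeRing.rawRing M) (ΠRaw k fields) φ
  iso = FiniteRing.Splitting[1]⇒isRingIsomorphism M card splitting

decomposition⇒meadow : ∀ {c ℓ} (M : CommutativeRing c ℓ) {n} → PrimePowerFieldDecomposition M n → IsMeadow M
decomposition⇒meadow M (_ , _ , _ , F , _ , _ , cards , (_ , iso) , _) =
  RingIsomorphism.meadow M F iso λ i →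
    field⇒meadow (proj₁ (F i)) (proj₂ (F i)) (FiniteRing._≟_ (proj₁ (F i)) (cards i))

mainTheorem2 : ∀ {c ℓ : Level} (M : CommutativeRing c ℓ) (n : ℕ) → HasCard M n →
    IsMeadow M ⇔
      (Σ ℕ λ k → Σ (Fin k → ℕ) λ p → Σ (Fin k → ℕ) λ e → Σ (Fin k → Field) λ F →
        (∀ i → Prime (p i)) × (∀ i → 1 ≤ e i) × (∀ i → HasCard (proj₁ (F i)) (p i ^ e i))
        × (∃ λ φ → RingMorphisms.IsRingIsomorphism (CommutativeRing.rawRing M) (ΠRaw k F) φ)
        × (n ≡ ∏ k (λ i → p i ^ e i)))
mainTheorem2 M n card = mk⇔ (finiteMeadow⇒decomposition M card) (decomposition⇒meadow M)
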